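{- Let $n$ be a positive integer and let $A=L\cup R$ be an MSTD set that is $P_n$ and contains $1$ and $2n$, where $L\subseteq[1,n]$ and $R\subseteq[n+1,2n]$. Let $m\ge 0$ be an integer, let $M\subseteq[n+1,n+m]$, let $R'=R+m$, and form $A'=L\cup M\cup R'$. If $A'$ is $SP_n$, then $A'$ is MSTD.
   Context: For integers $a\le b$, $[a,b]=\{\ell\in\mathbb{Z}:a\le\ell\le b\}$. For a set $A$ of integers, $A+A=\{x+y:x,y\in A\}$, $A-A=\{x-y:x,y\in A\}$, $A+t=\{x+t:x\in A\}$. A finite set $A$ is MSTD if $|A+A|>|A-A|$. For a finite set $A$ with $a=\min A$, $b=\max A$: $A$ is $SP_n$ if $A+A\supseteq[2a+n,2b-n]$; $A$ is $P_n$ if it is $SP_n$ and additionally $A-A\supseteq[(a-b)+n,(b-a)-n]$. -}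

module Defs where

open import Data.Nat using (ℕ)
open import Data.Integer using (ℤ; +_; _+_; _-_; _*_; _≤_; _<_)
open import Data.Integer.Properties using (_≟_)
open import Data.List using (List; map; concatMap; length; deduplicate)
open import Data.List.Membership.Propositional using (_∈_)
open import Data.Product using (_×_)

-- A finite set of integers is represented by a list of its elements
-- (duplicates allowed; the set is the set of list members).
FinSetℤ : Set
FinSetℤ = List ℤ

_⊕_ : FinSetℤ → FinSetℤ → FinSetℤ
A ⊕ B = concatMap (λ x → map (λ y → x + y) B) A

_⊖_ : FinSetℤ → FinSetℤ → FinSetℤ
A ⊖ B = concatMap (λ x → map (λ y → x - y) B) A

shift : FinSetℤ → ℤ → FinSetℤ
shift A t = map (λ x → x + t) A

card : FinSetℤ → ℕ
card A = length (deduplicate _≟_ A)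

_∈[_,_] : ℤ → ℤ → ℤ → Set
x ∈[ a , b ] = a ≤ x × x ≤ b

_⊆[_,_] : FinSetℤ → ℤ → ℤ → Set
A ⊆[ a , b ] = ∀ x → x ∈ A → x ∈[ a , b ]

_⊇[_,_] : FinSetℤ → ℤ → ℤ → Set
S ⊇[ a , b ] = ∀ k → k ∈[ a , b ] → k ∈ S

MSTD : FinSetℤ → Set
MSTD A = card (A ⊖ A) Data.Nat.< card (A ⊕ A)

IsMin : ℤ → FinSetℤ → Set
IsMin a A = a ∈ A × (∀ x → x ∈ A → a ≤ x)

IsMax : ℤ → FinSetℤ → Set
IsMax b A = b ∈ A × (∀ x → x ∈ A → x ≤ b)

SP : ℕ → FinSetℤ → Set
SP n A = ∀ a b → IsMin a A → IsMax b A →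
  (A ⊕ A) ⊇[ + 2 * a + + n , + 2 * b - + n ]

P : ℕ → FinSetℤ → Set
P n A = SP n A × (∀ a b → IsMin a A → IsMax b A →
  (A ⊖ A) ⊇[ (a - b) + + n , (b - a) - + n ])

module Submission where

-- Put N = n, K = m, A = L ∪ R ⊆ [1,2N] and A' = L ∪ M ∪ (R+K) ⊆ [1,2N+K].
-- The theorem follows from the two counting inequalities
--     |A+A| + 2m ≤ |A'+A'|     and     |A'-A'| ≤ |A-A| + 2m,
-- because then |A'-A'| ≤ |A-A| + 2m < |A+A| + 2m ≤ |A'+A'|.
-- * Sums.  g(s) = s for s ≤ 3N and g(s) = s + 2K otherwise is injective and
--   maps A+A into A'+A': sums ≤ N+1 come from L+L, sums > 3N from R+R (so
--   their shift by 2K is a sum in (R+K)+(R+K)), and all other sums lie in the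
--   interval [N+2, 3N+2K] covered by SP_n of A'.  The 2m integers of
--   (3N, 3N+2K] also lie in that interval, and g(A+A) avoids them.
-- * Differences.  With k(e) = e+K for e ≥ N, e-K for e ≤ -N, and e otherwise,
--   A'-A' ⊆ k(A-A) ∪ [N, N+K) ∪ (-N-K, -N]; the middle range [1-N, N-1]
--   is supplied by the difference part of P_n for A.
-- The file first proves general facts: a pigeonhole principle for lists and
-- its consequences for card, membership in sum and difference sets, lists of
-- consecutive integers and a slack rule for integer inequalities.  Then the
-- two inequalities are proved under the hypotheses of the theorem, which
-- comes last.

open import Defs
open import Data.Nat using (ℕ; _≥_)
open import Data.Integer using (ℤ; +_; _+_; _*_)
open import Data.List using (List; _++_)
open import Data.List.Membership.Propositional using (_∈_)

import Data.Nat as ℕ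
import Data.Nat.Properties as ℕP
open import Data.Integer using (_-_; -_; _≤_; _<_; +≤+; +<+; ∣_∣; 0ℤ)
open import Data.Integer.Properties using (_≤?_; _≟_)
import Data.Integer.Properties as ℤP
open import Algebra.Properties.AbelianGroup ℤP.+-0-abelianGroup using (∙-cancelˡ; ∙-cancelʳ)
open import Data.Integer.Tactic.RingSolver using (solve; solve-∀)
open import Data.List
  using ([]; _∷_; map; length; concatMap; cartesianProductWith; upTo; deduplicate)
open import Data.List.Properties using (length-map; length-++; length-upTo; length-removeAt′)
open import Data.List.Relation.Unary.Any using (here; there; index)
open import Data.List.Membership.Propositional using (_─_)
open import Data.List.Membership.Propositional.Properties
  using (∈-++⁺ˡ; ∈-++⁺ʳ; ∈-++⁻; ∈-map⁺; ∈-map⁻; ∈-upTo⁺; ∈-upTo⁻;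
         ∈-cartesianProductWith⁺; ∈-cartesianProductWith⁻; ∈-deduplicate⁺; ∈-deduplicate⁻)
open import Data.List.Relation.Unary.Unique.Propositional using (Unique)
import Data.List.Relation.Unary.Unique.Propositional.Properties as Unique
open import Data.List.Relation.Unary.Unique.DecPropositional.Properties _≟_ using (deduplicate-!)
open import Data.List.Relation.Unary.AllPairs using (_∷_)
import Data.List.Relation.Unary.All as All
open import Data.Product using (∃₂; _×_; _,_; proj₁; proj₂)
open import Data.Sum using (inj₁; inj₂)
open import Data.Empty using (⊥; ⊥-elim)
open import Relation.Nullary using (¬_; yes; no)
open import Relation.Binary.PropositionalEquality

module _ {X : Set} where

  ∈-─ : ∀ {x y} {ys : List X} (p : x ∈ ys) → y ∈ ys → y ≢ x → y ∈ ys ─ p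
  ∈-─ (here refl) (here refl) y≢x = ⊥-elim (y≢x refl)
  ∈-─ (here _)    (there q)   _   = q
  ∈-─ (there p)   (here refl) _   = here refl
  ∈-─ (there p)   (there q)   y≢x = there (∈-─ p q y≢x)

  unique-⊆⇒length-≤ : ∀ {xs ys : List X} → Unique xs →
    (∀ {z} → z ∈ xs → z ∈ ys) → length xs ℕ.≤ length ys
  unique-⊆⇒length-≤ {[]} _ _ = ℕ.z≤n
  unique-⊆⇒length-≤ {x ∷ xs} {ys} (x∉xs ∷ xs-unique) xs⊆ys = begin
    ℕ.suc (length xs)         ≤⟨ ℕ.s≤s (unique-⊆⇒length-≤ xs-unique xs⊆rest) ⟩
    ℕ.suc (length (ys ─ x∈ys)) ≡⟨ sym (length-removeAt′ ys (index x∈ys)) ⟩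
    length ys                 ∎
    where
    open ℕP.≤-Reasoning
    x∈ys : x ∈ ys
    x∈ys = xs⊆ys (here refl)
    xs⊆rest : ∀ {z} → z ∈ xs → z ∈ ys ─ x∈ys
    xs⊆rest z∈xs = ∈-─ x∈ys (xs⊆ys (there z∈xs)) (λ z≡x → All.lookup x∉xs z∈xs (sym z≡x))

card-≤-length : ∀ {S T : FinSetℤ} → (∀ {z} → z ∈ S → z ∈ T) → card S ℕ.≤ length T
card-≤-length {S} S⊆T =
  unique-⊆⇒length-≤ (deduplicate-! S) (λ z∈ → S⊆T (∈-deduplicate⁻ _≟_ S z∈))

length-≤-card : ∀ {U S : FinSetℤ} → Unique U → (∀ {z} → z ∈ U → z ∈ S) → length U ℕ.≤ card S
length-≤-card U-unique U⊆S = unique-⊆⇒length-≤ U-unique (λ z∈ → ∈-deduplicate⁺ _≟_ (U⊆S z∈))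

concatMap≡cartesianProductWith : {X Y Z : Set} (op : X → Y → Z) (xs : List X) (ys : List Y) →
  concatMap (λ x → map (op x) ys) xs ≡ cartesianProductWith op xs ys
concatMap≡cartesianProductWith op []       ys = refl
concatMap≡cartesianProductWith op (x ∷ xs) ys =
  cong (map (op x) ys ++_) (concatMap≡cartesianProductWith op xs ys)

∈-⊕⁺ : ∀ {a b A B} → a ∈ A → b ∈ B → a + b ∈ A ⊕ B
∈-⊕⁺ {A = A} {B} a∈A b∈B = subst (_ ∈_) (sym (concatMap≡cartesianProductWith _+_ A B))
  (∈-cartesianProductWith⁺ _+_ a∈A b∈B)

∈-⊕⁻ : ∀ {s} A B → s ∈ A ⊕ B → ∃₂ λ a b → a ∈ A × b ∈ B × s ≡ a + b
∈-⊕⁻ A B s∈ = ∈-cartesianProductWith⁻ _+_ A B (subst (_ ∈_) (concatMap≡cartesianProductWith _+_ A B) s∈)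

∈-⊖⁺ : ∀ {a b A B} → a ∈ A → b ∈ B → a - b ∈ A ⊖ B
∈-⊖⁺ {A = A} {B} a∈A b∈B = subst (_ ∈_) (sym (concatMap≡cartesianProductWith _-_ A B))
  (∈-cartesianProductWith⁺ _-_ a∈A b∈B)

∈-⊖⁻ : ∀ {d} A B → d ∈ A ⊖ B → ∃₂ λ a b → a ∈ A × b ∈ B × d ≡ a - b
∈-⊖⁻ A B d∈ = ∈-cartesianProductWith⁻ _-_ A B (subst (_ ∈_) (concatMap≡cartesianProductWith _-_ A B) d∈)

-- b exceeds a by a non-negative slack c.  The linear inequalities below are
-- all obtained this way, the equation a + c ≡ b being closed by the ring solver.
≤-by-slack : ∀ {a b} c → 0ℤ ≤ c → a + c ≡ b → a ≤ b
≤-by-slack {a} c 0≤c refl = subst (_≤ a + c) (ℤP.+-identityʳ a) (ℤP.+-monoʳ-≤ a 0≤c)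

infixl 6 _⊞_
_⊞_ : ∀ {a b} → 0ℤ ≤ a → 0ℤ ≤ b → 0ℤ ≤ a + b
_⊞_ = ℤP.+-mono-≤

gap : ∀ {a b} → a ≤ b → 0ℤ ≤ b - a
gap = ℤP.i≤j⇒0≤j-i

0≤+ : ∀ {n} → 0ℤ ≤ + n
0≤+ = +≤+ ℕ.z≤n

<⇒+1≤ : ∀ {a b} → a < b → a + + 1 ≤ b
<⇒+1≤ {a} a<b = subst (_≤ _) (ℤP.+-comm (+ 1) a) (ℤP.i<j⇒suc[i]≤j a<b)

+1≤⇒< : ∀ {a b} → a + + 1 ≤ b → a < b
+1≤⇒< {a} a+1≤b = ℤP.suc[i]≤j⇒i<j (subst (_≤ _) (ℤP.+-comm a (+ 1)) a+1≤b)

≰⇒+1≤ : ∀ {a b} → ¬ (a ≤ b) → b + + 1 ≤ a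
≰⇒+1≤ a≰b = <⇒+1≤ (ℤP.≰⇒> a≰b)

≤-and-+1≤-absurd : ∀ {a b} → a ≤ b → b + + 1 ≤ a → ⊥
≤-and-+1≤-absurd a≤b b+1≤a = ℤP.<⇒≱ (+1≤⇒< b+1≤a) a≤b

a+b-a≡b : ∀ a b → a + b - a ≡ b
a+b-a≡b = solve-∀

-- Agda evaluates ℤ multiplication by a literal, which hides + 2 * x from the
-- reflective ring solver; such products are therefore rewritten as sums.
double : ∀ x → + 2 * x ≡ x + x
double = solve-∀

diff-in-window : ∀ {lo w x y} → x ∈[ lo , lo + w ] → y ∈[ lo , lo + w ] → (x - y) ∈[ - w , w ]
diff-in-window {lo} {w} {x} {y} (lo≤x , x≤hi) (lo≤y , y≤hi) =
  ≤-by-slack ((x - lo) + (lo + w - y)) (gap lo≤x ⊞ gap y≤hi) (solve (lo ∷ w ∷ x ∷ y ∷ [])) ,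
  ≤-by-slack ((lo + w - x) + (y - lo)) (gap x≤hi ⊞ gap lo≤y) (solve (lo ∷ w ∷ x ∷ y ∷ []))

interval : ℤ → ℕ → List ℤ
interval a k = map (λ i → a + + i) (upTo k)

length-interval : ∀ a k → length (interval a k) ≡ k
length-interval a k = trans (length-map _ (upTo k)) (length-upTo k)

interval-unique : ∀ a k → Unique (interval a k)
interval-unique a k = Unique.map⁺ (λ eq → ℤP.+-injective (∙-cancelˡ a _ _ eq)) (Unique.upTo⁺ k)

∈-interval⁻ : ∀ a k {x} → x ∈ interval a k → a ≤ x × x < a + + k
∈-interval⁻ a k x∈ with ∈-map⁻ (λ i → a + + i) x∈
... | i , i<k , refl = ℤP.i≤i+j a (+ i) , ℤP.+-monoʳ-< a (+<+ (∈-upTo⁻ i<k))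

∈-interval⁺ : ∀ {a k x} → a ≤ x → x < a + + k → x ∈ interval a k
∈-interval⁺ {a} {k} {x} a≤x x<a+k =
  subst (_∈ interval a k) a+j≡x (∈-map⁺ (λ i → a + + i) (∈-upTo⁺ j<k))
  where
  j : ℕ
  j = ∣ x - a ∣
  +j≡x-a : + j ≡ x - a
  +j≡x-a = ℤP.0≤i⇒+∣i∣≡i (gap a≤x)
  a+j≡x : a + + j ≡ x
  a+j≡x = trans (cong (λ t → a + t) +j≡x-a) (solve (a ∷ x ∷ []))
  j<k : j ℕ.< k
  j<k = ℤP.drop‿+<+ (subst₂ _<_ (sym +j≡x-a) (a+b-a≡b a (+ k)) (ℤP.+-monoˡ-< (- a) x<a+k))

-- N and K stand for n and m; they are kept abstract so that the ring solver
-- treats them as variables, and K ≡ + m relates K to the number m of new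
-- elements counted on each side.
module Construction (N K : ℤ) (m : ℕ) (K≡m : K ≡ + m) (1≤N : + 1 ≤ N) (L R M : List ℤ)
  (L⊆ : L ⊆[ + 1 , N ]) (R⊆ : R ⊆[ N + + 1 , + 2 * N ]) (M⊆ : M ⊆[ N + + 1 , N + K ])
  (1∈A : + 1 ∈ L ++ R) (2N∈A : + 2 * N ∈ L ++ R)
  where

  A : FinSetℤ
  A = L ++ R

  A' : FinSetℤ
  A' = L ++ (M ++ shift R K)

  0≤N : 0ℤ ≤ N
  0≤N = ℤP.≤-trans 0≤+ 1≤N

  0≤K : 0ℤ ≤ K
  0≤K = subst (0ℤ ≤_) (sym K≡m) 0≤+

  R-bounds : ∀ {r} → r ∈ R → r ∈[ N + + 1 , N + N ]
  R-bounds {r} r∈R = proj₁ (R⊆ r r∈R) , subst (r ≤_) (double N) (proj₂ (R⊆ r r∈R))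

  1∈L : + 1 ∈ L
  1∈L with ∈-++⁻ L 1∈A
  ... | inj₁ 1∈L = 1∈L
  ... | inj₂ 1∈R = ⊥-elim (≤-and-+1≤-absurd (proj₁ (R-bounds 1∈R))
                     (≤-by-slack (N - + 1) (gap 1≤N) (solve (N ∷ []))))

  2N∈R : N + N ∈ R
  2N∈R with ∈-++⁻ L (subst (_∈ A) (double N) 2N∈A)
  ... | inj₂ 2N∈R = 2N∈R
  ... | inj₁ 2N∈L = ⊥-elim (≤-and-+1≤-absurd (proj₂ (L⊆ _ 2N∈L))
                     (≤-by-slack (N - + 1) (gap 1≤N) (solve (N ∷ []))))

  A⊆ : A ⊆[ + 1 , N + N ]
  A⊆ x x∈A with ∈-++⁻ L x∈A
  ... | inj₁ x∈L = proj₁ (L⊆ x x∈L) ,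
                   ≤-by-slack (N - x + N) (gap (proj₂ (L⊆ x x∈L)) ⊞ 0≤N) (solve (x ∷ N ∷ []))
  ... | inj₂ x∈R =
        ≤-by-slack (x - (N + + 1) + N) (gap (proj₁ (R-bounds x∈R)) ⊞ 0≤N) (solve (x ∷ N ∷ [])) ,
        proj₂ (R-bounds x∈R)

  minA : IsMin (+ 1) A
  minA = ∈-++⁺ˡ 1∈L , λ x x∈A → proj₁ (A⊆ x x∈A)

  maxA : IsMax (N + N) A
  maxA = ∈-++⁺ʳ L 2N∈R , λ x x∈A → proj₂ (A⊆ x x∈A)

  data Part (x : ℤ) : Set where
    fromL : x ∈ L → Part x
    fromM : x ∈[ N + + 1 , N + K ] → Part x
    fromR : ∀ r → r ∈ R → x ≡ r + K → Part x

  part : ∀ {x} → x ∈ A' → Part x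
  part {x} x∈A' with ∈-++⁻ L x∈A'
  ... | inj₁ x∈L = fromL x∈L
  ... | inj₂ x∈rest with ∈-++⁻ M x∈rest
  ...   | inj₁ x∈M = fromM (M⊆ x x∈M)
  ...   | inj₂ x∈R+K with ∈-map⁻ (λ r → r + K) x∈R+K
  ...     | r , r∈R , x≡r+K = fromR r r∈R x≡r+K

  R+K⊆A' : ∀ {r} → r ∈ R → r + K ∈ A'
  R+K⊆A' r∈R = ∈-++⁺ʳ L (∈-++⁺ʳ M (∈-map⁺ (λ r → r + K) r∈R))

  A'⊆ : A' ⊆[ + 1 , N + N + K ]
  A'⊆ x x∈A' with part x∈A'
  ... | fromL x∈L = proj₁ (L⊆ x x∈L) ,
        ≤-by-slack (N - x + N + K) (gap (proj₂ (L⊆ x x∈L)) ⊞ 0≤N ⊞ 0≤K) (solve (x ∷ N ∷ K ∷ []))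
  ... | fromM (lo , hi) =
        ≤-by-slack (x - (N + + 1) + N) (gap lo ⊞ 0≤N) (solve (x ∷ N ∷ [])) ,
        ≤-by-slack (N + K - x + N) (gap hi ⊞ 0≤N) (solve (x ∷ N ∷ K ∷ []))
  ... | fromR r r∈R refl =
        ≤-by-slack (r - (N + + 1) + N + K) (gap (proj₁ (R-bounds r∈R)) ⊞ 0≤N ⊞ 0≤K)
          (solve (r ∷ N ∷ K ∷ [])) ,
        ≤-by-slack (N + N - r) (gap (proj₂ (R-bounds r∈R))) (solve (r ∷ N ∷ K ∷ []))

  minA' : IsMin (+ 1) A'
  minA' = ∈-++⁺ˡ 1∈L , λ x x∈A' → proj₁ (A'⊆ x x∈A')

  maxA' : IsMax (N + N + K) A'
  maxA' = R+K⊆A' 2N∈R , λ x x∈A' → proj₂ (A'⊆ x x∈A')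

  -- Sums: |A+A| + 2m ≤ |A'+A'|

  module Sums (SP-A' : ∀ a b → IsMin a A' → IsMax b A' →
                 (A' ⊕ A') ⊇[ + 2 * a + N , + 2 * b - N ]) where

    -- SP_n for A', whose extremes are 1 and 2N+K: [N+2, 3N+2K] ⊆ A'+A'.
    middle-sums : ∀ s → s ∈[ N + + 2 , N + N + N + (K + K) ] → s ∈ A' ⊕ A'
    middle-sums s (lo , hi) = SP-A' (+ 1) (N + N + K) minA' maxA' s
      ( subst (_≤ s) (ℤP.+-comm N (+ 2)) lo
      , subst (s ≤_) upper≡ hi )
      where
      upper≡ : N + N + N + (K + K) ≡ + 2 * (N + N + K) - N
      upper≡ = begin
        N + N + N + (K + K)         ≡⟨ solve (N ∷ K ∷ []) ⟩
        (N + N + K) + (N + N + K) - N ≡⟨ cong (_- N) (sym (double (N + N + K))) ⟩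
        + 2 * (N + N + K) - N       ∎
        where open ≡-Reasoning

    g : ℤ → ℤ
    g s with s ≤? N + N + N
    ... | yes _ = s
    ... | no _  = s + (K + K)

    -- g is the identity up to 3N and lands above 3N beyond, hence injective.
    above-3N : ∀ {t} → ¬ t ≤ N + N + N → N + N + N + + 1 ≤ t + (K + K)
    above-3N {t} t≰3N =
      ≤-by-slack (t - (N + N + N + + 1) + (K + K)) (gap (≰⇒+1≤ t≰3N) ⊞ (0≤K ⊞ 0≤K))
        (solve (t ∷ N ∷ K ∷ []))

    g-injective : ∀ {s t} → g s ≡ g t → s ≡ t
    g-injective {s} {t} gs≡gt with s ≤? N + N + N | t ≤? N + N + N
    ... | yes _    | yes _    = gs≡gt
    ... | no _     | no _     = ∙-cancelʳ (K + K) s t gs≡gt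
    ... | yes s≤3N | no t≰3N  =
      ⊥-elim (≤-and-+1≤-absurd (subst (_≤ N + N + N) gs≡gt s≤3N) (above-3N t≰3N))
    ... | no s≰3N  | yes t≤3N =
      ⊥-elim (≤-and-+1≤-absurd (subst (_≤ N + N + N) (sym gs≡gt) t≤3N) (above-3N s≰3N))

    gap-sums : List ℤ
    gap-sums = interval (N + N + N + + 1) (m ℕ.+ m)

    ∈-gap-sums⁻ : ∀ {z} → z ∈ gap-sums → N + N + N + + 1 ≤ z × z < N + N + N + + 1 + (K + K)
    ∈-gap-sums⁻ {z} z∈gap =
      proj₁ z∈interval , subst (λ t → z < N + N + N + + 1 + t) 2m≡2K (proj₂ z∈interval)
      where
      z∈interval : N + N + N + + 1 ≤ z × z < N + N + N + + 1 + + (m ℕ.+ m)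
      z∈interval = ∈-interval⁻ (N + N + N + + 1) (m ℕ.+ m) z∈gap
      2m≡2K : + (m ℕ.+ m) ≡ K + K
      2m≡2K = sym (cong₂ _+_ K≡m K≡m)

    gap-sums⊆A'⊕A' : ∀ {z} → z ∈ gap-sums → z ∈ A' ⊕ A'
    gap-sums⊆A'⊕A' {z} z∈gap = middle-sums z
      ( ≤-by-slack (z - (N + N + N + + 1) + (N - + 1) + N) (gap lo ⊞ gap 1≤N ⊞ 0≤N) (solve (z ∷ N ∷ []))
      , ≤-by-slack (N + N + N + + 1 + (K + K) - (z + + 1)) (gap (<⇒+1≤ hi)) (solve (z ∷ N ∷ K ∷ [])) )
      where
      lo : N + N + N + + 1 ≤ z
      lo = proj₁ (∈-gap-sums⁻ z∈gap)
      hi : z < N + N + N + + 1 + (K + K)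
      hi = proj₂ (∈-gap-sums⁻ z∈gap)

    g-avoids-gap : ∀ s → ¬ g s ∈ gap-sums
    g-avoids-gap s with s ≤? N + N + N
    ... | yes s≤3N = λ s∈gap → ≤-and-+1≤-absurd s≤3N (proj₁ (∈-gap-sums⁻ s∈gap))
    ... | no s≰3N  = λ s+2K∈gap →
      ℤP.<⇒≱ (proj₂ (∈-gap-sums⁻ s+2K∈gap)) (ℤP.+-monoˡ-≤ (K + K) (≰⇒+1≤ s≰3N))

    small-sum⇒∈L : ∀ {x y} → x ∈ A → y ∈ A → x + y ≤ N + + 1 → x ∈ L
    small-sum⇒∈L {x} {y} x∈A y∈A x+y≤N+1 with ∈-++⁻ L x∈A
    ... | inj₁ x∈L = x∈L
    ... | inj₂ x∈R = ⊥-elim (≤-and-+1≤-absurd x+y≤N+1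
          (≤-by-slack (x - (N + + 1) + (y - + 1)) (gap (proj₁ (R-bounds x∈R)) ⊞ gap (proj₁ (A⊆ y y∈A)))
            (solve (x ∷ y ∷ N ∷ []))))

    large-sum⇒∈R : ∀ {x y} → x ∈ A → y ∈ A → N + N + N + + 1 ≤ x + y → x ∈ R
    large-sum⇒∈R {x} {y} x∈A y∈A 3N<x+y with ∈-++⁻ L x∈A
    ... | inj₂ x∈R = x∈R
    ... | inj₁ x∈L = ⊥-elim (≤-and-+1≤-absurd x+y≤3N 3N<x+y)
      where
      x+y≤3N : x + y ≤ N + N + N
      x+y≤3N = ≤-by-slack (N - x + (N + N - y)) (gap (proj₂ (L⊆ x x∈L)) ⊞ gap (proj₂ (A⊆ y y∈A)))
        (solve (x ∷ y ∷ N ∷ []))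

    g-sum∈A'⊕A' : ∀ {x y} → x ∈ A → y ∈ A → g (x + y) ∈ A' ⊕ A'
    g-sum∈A'⊕A' {x} {y} x∈A y∈A with x + y ≤? N + N + N
    ... | no x+y≰3N = subst (_∈ A' ⊕ A') shifted-sum
          (∈-⊕⁺ (R+K⊆A' (large-sum⇒∈R x∈A y∈A big)) (R+K⊆A' (large-sum⇒∈R y∈A x∈A big′)))
      where
      shifted-sum : (x + K) + (y + K) ≡ x + y + (K + K)
      shifted-sum = solve (x ∷ y ∷ K ∷ [])
      big : N + N + N + + 1 ≤ x + y
      big = ≰⇒+1≤ x+y≰3N
      big′ : N + N + N + + 1 ≤ y + x
      big′ = subst (N + N + N + + 1 ≤_) (ℤP.+-comm x y) big
    ... | yes x+y≤3N with x + y ≤? N + + 1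
    ...   | yes small = ∈-⊕⁺ (∈-++⁺ˡ (small-sum⇒∈L x∈A y∈A small))
                            (∈-++⁺ˡ (small-sum⇒∈L y∈A x∈A (subst (_≤ N + + 1) (ℤP.+-comm x y) small)))
    ...   | no not-small = middle-sums (x + y)
            ( ≤-by-slack (x + y - (N + + 1 + + 1)) (gap (≰⇒+1≤ not-small)) (solve (x ∷ y ∷ N ∷ []))
            , ≤-by-slack (N + N + N - (x + y) + (K + K)) (gap x+y≤3N ⊞ (0≤K ⊞ 0≤K))
                (solve (x ∷ y ∷ N ∷ K ∷ [])) )

    lifted-sums : List ℤ
    lifted-sums = map g (deduplicate _≟_ (A ⊕ A)) ++ gap-sums

    lifted-sums-unique : Unique lifted-sums
    lifted-sums-unique =
      Unique.++⁺ (Unique.map⁺ g-injective (deduplicate-! (A ⊕ A)))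
                 (interval-unique (N + N + N + + 1) (m ℕ.+ m)) disjoint
      where
      disjoint : ∀ {v} → ¬ (v ∈ map g (deduplicate _≟_ (A ⊕ A)) × v ∈ gap-sums)
      disjoint (v∈image , v∈gap) with ∈-map⁻ g v∈image
      ... | s , _ , refl = g-avoids-gap s v∈gap

    lifted-sums⊆A'⊕A' : ∀ {z} → z ∈ lifted-sums → z ∈ A' ⊕ A'
    lifted-sums⊆A'⊕A' z∈ with ∈-++⁻ (map g (deduplicate _≟_ (A ⊕ A))) z∈
    ... | inj₂ z∈gap = gap-sums⊆A'⊕A' z∈gap
    ... | inj₁ z∈image with ∈-map⁻ g z∈image
    ...   | s , s∈ , refl with ∈-⊕⁻ A A (∈-deduplicate⁻ _≟_ (A ⊕ A) s∈)
    ...     | x , y , x∈A , y∈A , refl = g-sum∈A'⊕A' x∈A y∈A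

    sum-inequality : card (A ⊕ A) ℕ.+ (m ℕ.+ m) ℕ.≤ card (A' ⊕ A')
    sum-inequality = subst (ℕ._≤ card (A' ⊕ A')) length-lifted-sums
      (length-≤-card lifted-sums-unique lifted-sums⊆A'⊕A')
      where
      length-lifted-sums : length lifted-sums ≡ card (A ⊕ A) ℕ.+ (m ℕ.+ m)
      length-lifted-sums = trans (length-++ (map g (deduplicate _≟_ (A ⊕ A))))
        (cong₂ ℕ._+_ (length-map g (deduplicate _≟_ (A ⊕ A)))
                     (length-interval (N + N + N + + 1) (m ℕ.+ m)))

  -- Differences: |A'-A'| ≤ |A-A| + 2m

  module Differences (P-A : ∀ a b → IsMin a A → IsMax b A →
                        (A ⊖ A) ⊇[ (a - b) + N , (b - a) - N ]) where

    -- P_n for A, whose extremes are 1 and 2N: every d with -N < d < N is in A-A.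
    middle-diffs : ∀ d → - N + + 1 ≤ d → d + + 1 ≤ N → d ∈ A ⊖ A
    middle-diffs d lo hi = P-A (+ 1) (N + N) minA maxA d
      ( subst (_≤ d) lower≡ lo
      , ≤-by-slack (N - (d + + 1)) (gap hi) (solve (d ∷ N ∷ [])) )
      where
      lower≡ : - N + + 1 ≡ (+ 1 - (N + N)) + N
      lower≡ = solve (N ∷ [])

    k : ℤ → ℤ
    k e with N ≤? e
    ... | yes _ = e + K
    ... | no _ with e ≤? - N
    ...   | yes _ = e - K
    ...   | no _  = e

    k-above : ∀ {e} → N ≤ e → k e ≡ e + K
    k-above {e} N≤e with N ≤? e
    ... | yes _   = refl
    ... | no N≰e  = ⊥-elim (N≰e N≤e)

    k-below : ∀ {e} → e ≤ - N → k e ≡ e - K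
    k-below {e} e≤-N with N ≤? e
    ... | yes N≤e = ⊥-elim (≤-and-+1≤-absurd e≤-N -N<e)
      where
      -N<e : - N + + 1 ≤ e
      -N<e = ≤-by-slack (e - N + (N - + 1) + N) (gap N≤e ⊞ gap 1≤N ⊞ 0≤N) (solve (e ∷ N ∷ []))
    ... | no _ with e ≤? - N
    ...   | yes _    = refl
    ...   | no e≰-N  = ⊥-elim (e≰-N e≤-N)

    k-middle : ∀ {e} → ¬ N ≤ e → ¬ e ≤ - N → k e ≡ e
    k-middle {e} N≰e e≰-N with N ≤? e
    ... | yes N≤e = ⊥-elim (N≰e N≤e)
    ... | no _ with e ≤? - N
    ...   | yes e≤-N = ⊥-elim (e≰-N e≤-N)
    ...   | no _     = refl

    covering : List ℤ
    covering = map k (deduplicate _≟_ (A ⊖ A)) ++ (interval N m ++ interval (- (N + K - + 1)) m)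

    k-diff∈covering : ∀ {e} → e ∈ A ⊖ A → k e ∈ covering
    k-diff∈covering e∈ = ∈-++⁺ˡ (∈-map⁺ k (∈-deduplicate⁺ _≟_ e∈))

    short∈covering : ∀ {d} → d ∈[ - (N + K - + 1) , (N + K - + 1) ] → d ∈ covering
    short∈covering {d} (lo , hi) with N ≤? d
    ... | yes N≤d = ∈-++⁺ʳ (map k (deduplicate _≟_ (A ⊖ A))) (∈-++⁺ˡ (∈-interval⁺ N≤d d<N+m))
      where
      d<N+m : d < N + + m
      d<N+m = subst (λ t → d < N + t) K≡m
        (+1≤⇒< (≤-by-slack ((N + K - + 1) - d) (gap hi) (solve (d ∷ N ∷ K ∷ []))))
    ... | no N≰d with d ≤? - N
    ...   | yes d≤-N =
      ∈-++⁺ʳ (map k (deduplicate _≟_ (A ⊖ A))) (∈-++⁺ʳ (interval N m) (∈-interval⁺ lo d<N+K-1+m))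
      where
      d<N+K-1+m : d < - (N + K - + 1) + + m
      d<N+K-1+m = subst (λ t → d < - (N + K - + 1) + t) K≡m
        (+1≤⇒< (≤-by-slack (- N - d) (gap d≤-N) (solve (d ∷ N ∷ K ∷ []))))
    ...   | no d≰-N = subst (_∈ covering) (k-middle N≰d d≰-N)
                        (k-diff∈covering (middle-diffs d (≰⇒+1≤ d≰-N) (≰⇒+1≤ N≰d)))

    -- L ∪ M lies in the window [1, N+K] and M ∪ (R+K) in [N+1, 2N+K], both of
    -- width N+K-1, so differences inside one window are short.
    L-low : ∀ {x} → x ∈ L → x ∈[ + 1 , + 1 + (N + K - + 1) ]
    L-low {x} x∈L = proj₁ (L⊆ x x∈L) ,
      ≤-by-slack (N - x + K) (gap (proj₂ (L⊆ x x∈L)) ⊞ 0≤K) (solve (x ∷ N ∷ K ∷ []))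

    M-low : ∀ {x} → x ∈[ N + + 1 , N + K ] → x ∈[ + 1 , + 1 + (N + K - + 1) ]
    M-low {x} (lo , hi) =
      ≤-by-slack (x - (N + + 1) + N) (gap lo ⊞ 0≤N) (solve (x ∷ N ∷ [])) ,
      ≤-by-slack (N + K - x) (gap hi) (solve (x ∷ N ∷ K ∷ []))

    M-high : ∀ {x} → x ∈[ N + + 1 , N + K ] → x ∈[ N + + 1 , N + + 1 + (N + K - + 1) ]
    M-high {x} (lo , hi) = lo , ≤-by-slack (N + K - x + N) (gap hi ⊞ 0≤N) (solve (x ∷ N ∷ K ∷ []))

    R-high : ∀ {r} → r ∈ R → (r + K) ∈[ N + + 1 , N + + 1 + (N + K - + 1) ]
    R-high {r} r∈R =
      ≤-by-slack (r - (N + + 1) + K) (gap (proj₁ (R-bounds r∈R)) ⊞ 0≤K) (solve (r ∷ N ∷ K ∷ [])) ,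
      ≤-by-slack (N + N - r) (gap (proj₂ (R-bounds r∈R))) (solve (r ∷ N ∷ K ∷ []))

    window∈covering : ∀ lo {x y} → x ∈[ lo , lo + (N + K - + 1) ] → y ∈[ lo , lo + (N + K - + 1) ] →
      x - y ∈ covering
    window∈covering lo x∈ y∈ = short∈covering (diff-in-window x∈ y∈)

    right-left∈covering : ∀ {r l} → r ∈ R → l ∈ L → (r + K) - l ∈ covering
    right-left∈covering {r} {l} r∈R l∈L with N ≤? r - l
    ... | yes N≤r-l = subst (_∈ covering) k[r-l]≡ (k-diff∈covering (∈-⊖⁺ (∈-++⁺ʳ L r∈R) (∈-++⁺ˡ l∈L)))
      where
      k[r-l]≡ : k (r - l) ≡ (r + K) - l
      k[r-l]≡ = trans (k-above N≤r-l) (solve (r ∷ l ∷ K ∷ []))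
    ... | no N≰r-l = short∈covering (lo , hi)
      where
      lo : - (N + K - + 1) ≤ (r + K) - l
      lo = ≤-by-slack (r - (N + + 1) + (N - l) + N + K + K)
        (gap (proj₁ (R-bounds r∈R)) ⊞ gap (proj₂ (L⊆ l l∈L)) ⊞ 0≤N ⊞ 0≤K ⊞ 0≤K)
        (solve (r ∷ l ∷ N ∷ K ∷ []))
      hi : (r + K) - l ≤ N + K - + 1
      hi = ≤-by-slack (N - (r - l + + 1)) (gap (≰⇒+1≤ N≰r-l)) (solve (r ∷ l ∷ N ∷ K ∷ []))

    left-right∈covering : ∀ {l r} → l ∈ L → r ∈ R → l - (r + K) ∈ covering
    left-right∈covering {l} {r} l∈L r∈R with l - r ≤? - N
    ... | yes l-r≤-N = subst (_∈ covering) k[l-r]≡ (k-diff∈covering (∈-⊖⁺ (∈-++⁺ˡ l∈L) (∈-++⁺ʳ L r∈R)))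
      where
      k[l-r]≡ : k (l - r) ≡ l - (r + K)
      k[l-r]≡ = trans (k-below l-r≤-N) (solve (r ∷ l ∷ K ∷ []))
    ... | no l-r≰-N = short∈covering (lo , hi)
      where
      lo : - (N + K - + 1) ≤ l - (r + K)
      lo = ≤-by-slack (l - r - (- N + + 1)) (gap (≰⇒+1≤ l-r≰-N)) (solve (r ∷ l ∷ N ∷ K ∷ []))
      hi : l - (r + K) ≤ N + K - + 1
      hi = ≤-by-slack (N - l + (r - (N + + 1)) + N + K + K)
        (gap (proj₂ (L⊆ l l∈L)) ⊞ gap (proj₁ (R-bounds r∈R)) ⊞ 0≤N ⊞ 0≤K ⊞ 0≤K)
        (solve (r ∷ l ∷ N ∷ K ∷ []))

    diff∈covering : ∀ {x y} → x ∈ A' → y ∈ A' → x - y ∈ covering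
    diff∈covering x∈A' y∈A' with part x∈A' | part y∈A'
    ... | fromL x∈L        | fromL y∈L        = window∈covering (+ 1) (L-low x∈L) (L-low y∈L)
    ... | fromL x∈L        | fromM y∈M        = window∈covering (+ 1) (L-low x∈L) (M-low y∈M)
    ... | fromM x∈M        | fromL y∈L        = window∈covering (+ 1) (M-low x∈M) (L-low y∈L)
    ... | fromM x∈M        | fromM y∈M        = window∈covering (+ 1) (M-low x∈M) (M-low y∈M)
    ... | fromM x∈M        | fromR _ r∈R refl = window∈covering (N + + 1) (M-high x∈M) (R-high r∈R)
    ... | fromR _ r∈R refl | fromM y∈M        = window∈covering (N + + 1) (R-high r∈R) (M-high y∈M)
    ... | fromR _ r∈R refl | fromR _ s∈R refl = window∈covering (N + + 1) (R-high r∈R) (R-high s∈R)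
    ... | fromR _ r∈R refl | fromL y∈L        = right-left∈covering r∈R y∈L
    ... | fromL x∈L        | fromR _ r∈R refl = left-right∈covering x∈L r∈R

    diff-inequality : card (A' ⊖ A') ℕ.≤ card (A ⊖ A) ℕ.+ (m ℕ.+ m)
    diff-inequality = subst (card (A' ⊖ A') ℕ.≤_) length-covering (card-≤-length A'⊖A'⊆covering)
      where
      A'⊖A'⊆covering : ∀ {z} → z ∈ A' ⊖ A' → z ∈ covering
      A'⊖A'⊆covering z∈ with ∈-⊖⁻ A' A' z∈
      ... | x , y , x∈A' , y∈A' , refl = diff∈covering x∈A' y∈A'
      length-covering : length covering ≡ card (A ⊖ A) ℕ.+ (m ℕ.+ m)
      length-covering = trans (length-++ (map k (deduplicate _≟_ (A ⊖ A))))
        (cong₂ ℕ._+_ (length-map k (deduplicate _≟_ (A ⊖ A)))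
          (trans (length-++ (interval N m))
            (cong₂ ℕ._+_ (length-interval N m) (length-interval (- (N + K - + 1)) m))))

lemma2p1 : (n m : ℕ) → n ≥ 1 → (L R M : List ℤ) →
    L ⊆[ + 1 , + n ] → R ⊆[ + n + + 1 , + 2 * + n ] →
    MSTD (L ++ R) → P n (L ++ R) →
    + 1 ∈ (L ++ R) → + 2 * + n ∈ (L ++ R) →
    M ⊆[ + n + + 1 , + n + + m ] →
    SP n (L ++ (M ++ shift R (+ m))) →
    MSTD (L ++ (M ++ shift R (+ m)))
-- |A'-A'| ≤ |A-A| + 2m < |A+A| + 2m ≤ |A'+A'|.
lemma2p1 n m n≥1 L R M L⊆ R⊆ A-MSTD A-P 1∈A 2n∈A M⊆ A'-SP = begin-strict
  card (A' ⊖ A')             ≤⟨ diff-inequality ⟩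
  card (A ⊖ A) ℕ.+ (m ℕ.+ m) <⟨ ℕP.+-monoˡ-< (m ℕ.+ m) A-MSTD ⟩
  card (A ⊕ A) ℕ.+ (m ℕ.+ m) ≤⟨ sum-inequality ⟩
  card (A' ⊕ A')             ∎
  where
  open Construction (+ n) (+ m) m refl (+≤+ n≥1) L R M L⊆ R⊆ M⊆ 1∈A 2n∈A
  open Sums A'-SP
  open Differences (proj₂ A-P)
  open ℕP.≤-Reasoning
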